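{- If a finite graph $H$ contains an induced subgraph on at least $5$ vertices that is $3$-connected and not a clique, then the $3^*$-core of $H$ or the $3^*$-core of $\overline{H}$ is $3$-connected and not a clique.
   Context: $\overline{H}$ is the complement of $H$. The $3^*$-core of a graph is obtained by iteratively removing vertices which have at most $2$ neighbours and removing pairs of distinct vertices $u,v$ with $|N[u]\cup N[v]|\leq 4$, where $N[\cdot]$ is the closed neighbourhood in the current graph. A graph is $3$-connected if it has at least $4$ vertices and remains connected after removing any $2$ vertices. -}

module Defs where

open import Data.Nat using (ℕ; _≤_)
open import Data.Bool using (Bool; true; false; not; _∧_; _∨_)
open import Data.Fin using (Fin; _≟_)
open import Data.Fin.Subset using (Subset; _∈_; _∉_; _⊆_; _─_; _∪_; ⁅_⁆; ∣_∣; ⊤)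
open import Data.Vec using (tabulate; lookup)
open import Data.Product using (Σ; ∃; ∃-syntax; _×_; _,_)
open import Relation.Nullary using (¬_)
open import Relation.Nullary.Decidable using (⌊_⌋)
open import Relation.Binary.PropositionalEquality using (_≡_; _≢_)
open import Relation.Binary.Construct.Closure.ReflexiveTransitive using (Star)

record Graph (n : ℕ) : Set where
  field
    adj   : Fin n → Fin n → Bool
    sym   : ∀ u v → adj u v ≡ adj v u
    irrefl : ∀ v → adj v v ≡ false
open Graph public

complement : ∀ {n} → Graph n → Graph n
complement {n} G = record { adj = a ; sym = s ; irrefl = i }
  where
  a : Fin n → Fin n → Bool
  a u v = not (adj G u v) ∧ not ⌊ u ≟ v ⌋
  s : ∀ u v → a u v ≡ a v u
  s u v with adj G u v | adj G v u | sym G u v | u ≟ v | v ≟ u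
  ... | false | .false | _≡_.refl | Relation.Nullary.yes _ | Relation.Nullary.yes _ = _≡_.refl
  ... | false | .false | _≡_.refl | Relation.Nullary.yes p | Relation.Nullary.no q = Data.Empty.⊥-elim (q (Relation.Binary.PropositionalEquality.sym p))
    where import Data.Empty
  ... | false | .false | _≡_.refl | Relation.Nullary.no q | Relation.Nullary.yes p = Data.Empty.⊥-elim (q (Relation.Binary.PropositionalEquality.sym p))
    where import Data.Empty
  ... | false | .false | _≡_.refl | Relation.Nullary.no _ | Relation.Nullary.no _ = _≡_.refl
  ... | true | .true | _≡_.refl | _ | _ = _≡_.refl
  i : ∀ v → a v v ≡ false
  i v with v ≟ v
  ... | Relation.Nullary.yes _ with adj G v v
  ...   | true = _≡_.refl
  ...   | false = _≡_.refl
  i v | Relation.Nullary.no q = Data.Empty.⊥-elim (q _≡_.refl)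
    where import Data.Empty

module _ {n : ℕ} (G : Graph n) where

  nbhd : Subset n → Fin n → Subset n
  nbhd S u = tabulate (λ w → lookup S w ∧ adj G u w)

  cnbhd : Subset n → Fin n → Subset n
  cnbhd S u = tabulate (λ w → lookup S w ∧ (adj G u w ∨ ⌊ u ≟ w ⌋))

  data CoreStep (S : Subset n) : Subset n → Set where
    remove-vertex : ∀ v → v ∈ S → ∣ nbhd S v ∣ ≤ 2 → CoreStep S (S ─ ⁅ v ⁆)
    remove-pair   : ∀ u v → u ∈ S → v ∈ S → u ≢ v →
                    ∣ cnbhd S u ∪ cnbhd S v ∣ ≤ 4 →
                    CoreStep S ((S ─ ⁅ u ⁆) ─ ⁅ v ⁆)

  Is3StarCore : Subset n → Set
  Is3StarCore C = Star CoreStep ⊤ C × (∀ C' → ¬ CoreStep C C')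

  data Reach (T : Subset n) : Fin n → Fin n → Set where
    here : ∀ {u} → Reach T u u
    step : ∀ {u v w} → adj G u v ≡ true → v ∈ T → Reach T v w → Reach T u w

  Connected : Subset n → Set
  Connected T = ∀ u v → u ∈ T → v ∈ T → Reach T u v

  ThreeConnected : Subset n → Set
  ThreeConnected S = 4 ≤ ∣ S ∣ × (∀ X → X ⊆ S → ∣ X ∣ ≤ 2 → Connected (S ─ X))

  NotClique : Subset n → Set
  NotClique S = ∃[ u ] ∃[ v ] (u ∈ S × v ∈ S × u ≢ v × adj G u v ≡ false)

-- A 3-connected induced subgraph S on at least five vertices is never touched
-- by a reduction step, so it survives in the 3*-core C of H.  If C is not
-- 3-connected, some X with |X| ≤ 2 splits C ─ X into sides A and B with no
-- edges between them.  Irreducibility of C forces |A|, |B| ≥ 3, so in the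
-- complement A ∪ B spans a complete bipartite graph, which is 3-connected and
-- hence survives in the 3*-core D of the complement.  After deleting any two
-- vertices every vertex of D still reaches A ∪ B: vertices removed while
-- reducing H had at most three H-neighbours, hence a complement-neighbour in
-- A ∪ B, and vertices of X escape X because D is irreducible.
module Submission where

open import Defs renaming (sym to adj-sym)
open import Data.Bool using (Bool; true; false; _∧_; _∨_)
open import Data.Bool.Properties using (∨-zeroʳ; ¬-not) renaming (_≟_ to _≟ᵇ_)
open import Data.Empty using (⊥-elim)
open import Data.Fin using (Fin; _≟_)
open import Data.Fin.Properties using (any?; all?)
open import Data.Fin.Subset
  using (Subset; inside; outside; _∈_; _∉_; _⊆_; _─_; _-_; _∪_; _∩_; ⁅_⁆; ∣_∣; ⊤; Nonempty)
open import Data.Fin.Subset.Properties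
open import Data.Nat using (ℕ; zero; suc; _≤_; _<_; _+_; z≤n; s≤s; _≤?_)
open import Data.Nat.Properties
  using ( ≤-refl; ≤-trans; ≤-reflexive; ≤-pred; n≤1+n; ≤-<-trans; <-≤-trans; <⇒≱; ≰⇒>; ≤⇒≯
        ; +-suc; +-identityʳ; +-mono-≤; +-monoˡ-≤; +-cancelʳ-≤; m≤n+m)
open import Data.Product using (∃; ∃₂; ∃-syntax; _×_; _,_; proj₁; proj₂)
open import Data.Sum using (_⊎_; inj₁; inj₂)
open import Data.Vec using ([]; _∷_; tabulate; lookup; here; there)
open import Data.Vec.Properties using (lookup∘tabulate; []=⇒lookup; lookup⇒[]=)
open import Relation.Binary.PropositionalEquality
  using (_≡_; _≢_; refl; sym; trans; cong; subst)
open import Relation.Binary.Construct.Closure.ReflexiveTransitive using (Star; ε; _◅_)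
open import Function using (_∘_)
open import Relation.Nullary using (¬_; Dec; yes; no; contradiction)
open import Relation.Nullary.Decidable using (⌊_⌋; _×-dec_; _→-dec_; ¬?; decidable-stable)

private
  variable
    n : ℕ
    x y : Fin n
    p q : Subset n

x∈p─q⇒x∉q : x ∈ p ─ q → x ∉ q
x∈p─q⇒x∉q {p = _ ∷ _} {q = outside ∷ _} here        = λ ()
x∈p─q⇒x∉q {p = _ ∷ _} {q = _ ∷ _}       (there x∈) = λ { (there x∈q) → x∈p─q⇒x∉q x∈ x∈q }

x∈p∧x∉p-y⇒x≡y : x ∈ p → x ∉ p - y → x ≡ y
x∈p∧x∉p-y⇒x≡y {x = x} {y = y} x∈p x∉ =
  decidable-stable (x ≟ y) (λ x≢y → x∉ (x∈p∧x≢y⇒x∈p-y x∈p x≢y))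

⊆-or-∃∉ : (p q : Subset n) → p ⊆ q ⊎ ∃ λ x → x ∈ p × x ∉ q
⊆-or-∃∉ p q with any? (λ x → x ∈? p ×-dec ¬? (x ∈? q))
... | yes witness = inj₂ witness
... | no ∄ = inj₁ λ {x} x∈p → decidable-stable (x ∈? q) (λ x∉q → ∄ (x , x∈p , x∉q))

∣q∣<∣p∣⇒∃∈p∧∉q : ∣ q ∣ < ∣ p ∣ → ∃ λ x → x ∈ p × x ∉ q
∣q∣<∣p∣⇒∃∈p∧∉q {q = q} {p = p} ∣q∣<∣p∣ with ⊆-or-∃∉ p q
... | inj₁ p⊆q    = contradiction (p⊆q⇒∣p∣≤∣q∣ p⊆q) (<⇒≱ ∣q∣<∣p∣)
... | inj₂ witness = witness

∣p∪q∣≤∣p∣+∣q∣ : (p q : Subset n) → ∣ p ∪ q ∣ ≤ ∣ p ∣ + ∣ q ∣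
∣p∪q∣≤∣p∣+∣q∣ []            []            = z≤n
∣p∪q∣≤∣p∣+∣q∣ (inside ∷ p)  (inside ∷ q)  =
  s≤s (≤-trans (≤-trans (∣p∪q∣≤∣p∣+∣q∣ p q) (n≤1+n _)) (≤-reflexive (sym (+-suc ∣ p ∣ ∣ q ∣))))
∣p∪q∣≤∣p∣+∣q∣ (inside ∷ p)  (outside ∷ q) = s≤s (∣p∪q∣≤∣p∣+∣q∣ p q)
∣p∪q∣≤∣p∣+∣q∣ (outside ∷ p) (inside ∷ q)  =
  ≤-trans (s≤s (∣p∪q∣≤∣p∣+∣q∣ p q)) (≤-reflexive (sym (+-suc ∣ p ∣ ∣ q ∣)))
∣p∪q∣≤∣p∣+∣q∣ (outside ∷ p) (outside ∷ q) = ∣p∪q∣≤∣p∣+∣q∣ p q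

disjoint⇒∣p∪q∣≡∣p∣+∣q∣ : (p q : Subset n) → (∀ {x} → x ∈ p → x ∉ q) → ∣ p ∪ q ∣ ≡ ∣ p ∣ + ∣ q ∣
disjoint⇒∣p∪q∣≡∣p∣+∣q∣ []            []            _     = refl
disjoint⇒∣p∪q∣≡∣p∣+∣q∣ (inside ∷ p)  (inside ∷ q)  disj  = ⊥-elim (disj here here)
disjoint⇒∣p∪q∣≡∣p∣+∣q∣ (inside ∷ p)  (outside ∷ q) disj  =
  cong suc (disjoint⇒∣p∪q∣≡∣p∣+∣q∣ p q λ x∈p x∈q → disj (there x∈p) (there x∈q))
disjoint⇒∣p∪q∣≡∣p∣+∣q∣ (outside ∷ p) (inside ∷ q)  disj  =
  trans (cong suc (disjoint⇒∣p∪q∣≡∣p∣+∣q∣ p q λ x∈p x∈q → disj (there x∈p) (there x∈q)))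
        (sym (+-suc ∣ p ∣ ∣ q ∣))
disjoint⇒∣p∪q∣≡∣p∣+∣q∣ (outside ∷ p) (outside ∷ q) disj  =
  disjoint⇒∣p∪q∣≡∣p∣+∣q∣ p q λ x∈p x∈q → disj (there x∈p) (there x∈q)

p⊆r∧q⊆r⇒p∪q⊆r : {r : Subset n} → p ⊆ r → q ⊆ r → p ∪ q ⊆ r
p⊆r∧q⊆r⇒p∪q⊆r {p = p} {q = q} p⊆r q⊆r x∈ with x∈p∪q⁻ p q x∈
... | inj₁ x∈p = p⊆r x∈p
... | inj₂ x∈q = q⊆r x∈q

x∈p⇒⁅x⁆⊆p : x ∈ p → ⁅ x ⁆ ⊆ p
x∈p⇒⁅x⁆⊆p {x = x} x∈p y∈ = subst (_∈ _) (sym (x∈⁅y⁆⇒x≡y x y∈)) x∈p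

p∪q─q⊆p : (p q : Subset n) → p ∪ q ─ q ⊆ p
p∪q─q⊆p p q x∈ with x∈p∪q⁻ p q (p─q⊆p _ q x∈)
... | inj₁ x∈p = x∈p
... | inj₂ x∈q = contradiction x∈q (x∈p─q⇒x∉q x∈)

module _ {p : Subset n} {f : Fin n → Bool} where

  ∈-tabulate-∧⁻ : x ∈ tabulate (λ w → lookup p w ∧ f w) → x ∈ p × f x ≡ true
  ∈-tabulate-∧⁻ {x = x} x∈ with lookup p x in eq | trans (sym (lookup∘tabulate _ x)) ([]=⇒lookup x∈)
  ... | true | fx≡true = lookup⇒[]= x p eq , fx≡true

  ∈-tabulate-∧⁺ : x ∈ p → f x ≡ true → x ∈ tabulate (λ w → lookup p w ∧ f w)
  ∈-tabulate-∧⁺ {x = x} x∈p fx≡true =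
    lookup⇒[]= x _ (trans (lookup∘tabulate _ x)
                          (subst (λ b → b ∧ f x ≡ true) (sym ([]=⇒lookup x∈p)) fx≡true))

module _ {n : ℕ} (G : Graph n) where

  private
    variable
      u v w : Fin n
      A B C D P S T T′ Q X Y Z : Subset n

  ∈-nbhd⁻ : w ∈ nbhd G S u → w ∈ S × adj G u w ≡ true
  ∈-nbhd⁻ = ∈-tabulate-∧⁻

  ∈-nbhd⁺ : w ∈ S → adj G u w ≡ true → w ∈ nbhd G S u
  ∈-nbhd⁺ = ∈-tabulate-∧⁺

  ∈-cnbhd⁻ : w ∈ cnbhd G S u → w ∈ S × (adj G u w ≡ true ⊎ u ≡ w)
  ∈-cnbhd⁻ {w = w} {u = u} w∈ with ∈-tabulate-∧⁻ w∈
  ... | w∈S , adj∨≡ = w∈S , ∨-≟⁻ (adj G u w) adj∨≡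
    where
    ∨-≟⁻ : ∀ b → (b ∨ ⌊ u ≟ w ⌋) ≡ true → b ≡ true ⊎ u ≡ w
    ∨-≟⁻ true  _ = inj₁ refl
    ∨-≟⁻ false e with u ≟ w | e
    ... | yes u≡w | _ = inj₂ u≡w
    ... | no _    | ()

  ∈-cnbhd⁺ : w ∈ S → adj G u w ≡ true ⊎ u ≡ w → w ∈ cnbhd G S u
  ∈-cnbhd⁺ {w = w} {u = u} w∈S adj⊎≡ = ∈-tabulate-∧⁺ w∈S (∨-≟⁺ adj⊎≡)
    where
    ∨-≟⁺ : adj G u w ≡ true ⊎ u ≡ w → (adj G u w ∨ ⌊ u ≟ w ⌋) ≡ true
    ∨-≟⁺ (inj₁ e) rewrite e = refl
    ∨-≟⁺ (inj₂ refl) with u ≟ u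
    ... | yes _  = ∨-zeroʳ (adj G u u)
    ... | no u≢u = contradiction refl u≢u

  nbhd⊆cnbhd : nbhd G S u ⊆ cnbhd G S u
  nbhd⊆cnbhd {S = S} {u = u} w∈ with ∈-nbhd⁻ {S = S} {u = u} w∈
  ... | w∈S , e = ∈-cnbhd⁺ w∈S (inj₁ e)

  u∈cnbhd-u : u ∈ S → u ∈ cnbhd G S u
  u∈cnbhd-u u∈S = ∈-cnbhd⁺ u∈S (inj₂ refl)

  nbhd-mono : S ⊆ T → nbhd G S u ⊆ nbhd G T u
  nbhd-mono {S = S} {u = u} S⊆T w∈ with ∈-nbhd⁻ {S = S} {u = u} w∈
  ... | w∈S , e = ∈-nbhd⁺ (S⊆T w∈S) e

  adj⇒≢ : adj G u v ≡ true → u ≢ v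
  adj⇒≢ {u = u} e refl with trans (sym e) (irrefl G u)
  ... | ()

  u∉nbhd-u : u ∉ nbhd G S u
  u∉nbhd-u {u = u} {S = S} u∈ = adj⇒≢ (proj₂ (∈-nbhd⁻ {S = S} {u = u} u∈)) refl

  cnbhd⊆nbhd∪⁅u⁆ : cnbhd G S u ⊆ nbhd G S u ∪ ⁅ u ⁆
  cnbhd⊆nbhd∪⁅u⁆ {S = S} {u = u} w∈ with ∈-cnbhd⁻ {S = S} {u = u} w∈
  ... | w∈S , inj₁ e    = x∈p∪q⁺ (inj₁ (∈-nbhd⁺ w∈S e))
  ... | w∈S , inj₂ refl = x∈p∪q⁺ (inj₂ (x∈⁅x⁆ u))

  Reach-snoc : Reach G T u v → adj G v w ≡ true → w ∈ T → Reach G T u w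
  Reach-snoc here           e w∈T = step e w∈T here
  Reach-snoc (step e′ v∈ r) e w∈T = step e′ v∈ (Reach-snoc r e w∈T)

  Reach-trans : Reach G T u v → Reach G T v w → Reach G T u w
  Reach-trans here          r′ = r′
  Reach-trans (step e v∈ r) r′ = step e v∈ (Reach-trans r r′)

  Reach-sym : u ∈ T → Reach G T u v → Reach G T v u
  Reach-sym u∈T here = here
  Reach-sym {u = u} u∈T (step {v = v} e v∈T r) =
    Reach-snoc (Reach-sym v∈T r) (trans (adj-sym G v u) e) u∈T

  Reach-mono : S ⊆ T → Reach G S u v → Reach G T u v
  Reach-mono S⊆T here          = here
  Reach-mono S⊆T (step e v∈ r) = step e (S⊆T v∈) (Reach-mono S⊆T r)

  Closed : Subset n → Subset n → Set
  Closed T Q = ∀ q y → q ∈ Q → y ∈ T → adj G q y ≡ true → y ∈ Q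

  closed? : ∀ T Q → Dec (Closed T Q)
  closed? T Q = all? λ q → all? λ y →
    q ∈? Q →-dec y ∈? T →-dec adj G q y ≟ᵇ true →-dec y ∈? Q

  Reach-closed : Closed T Q → u ∈ Q → Reach G T u v → v ∈ Q
  Reach-closed closed u∈Q here          = u∈Q
  Reach-closed closed u∈Q (step e v∈ r) = Reach-closed closed (closed _ _ u∈Q v∈ e) r

  closed-complement : Closed T Q → Closed T (T ─ Q)
  closed-complement {T = T} {Q = Q} closed q y q∈ y∈T e with y ∈? Q
  ... | yes y∈Q = contradiction (closed y q y∈Q (p─q⊆p T Q q∈) (trans (adj-sym G y q) e)) (x∈p─q⇒x∉q q∈)
  ... | no y∉Q  = x∈p∧x∉q⇒x∈p─q y∈T y∉Q

  reach-or-cut : u ∈ T → (∀ {v} → v ∈ T → Reach G T u v) ⊎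
                 ∃ λ R → u ∈ R × R ⊆ T × Closed T R × ∃ λ v → v ∈ T × v ∉ R
  reach-or-cut {u = u} {T = T} u∈T =
    grow n ⁅ u ⁆ (m≤n+m n ∣ ⁅ u ⁆ ∣) (x∈⁅x⁆ u) (x∈p⇒⁅x⁆⊆p u∈T)
         (λ r∈ → subst (Reach G T u) (sym (x∈⁅y⁆⇒x≡y u r∈)) here)
    where
    ReachOrCut : Set
    ReachOrCut = (∀ {v} → v ∈ T → Reach G T u v) ⊎
                 ∃ λ R → u ∈ R × R ⊆ T × Closed T R × ∃ λ v → v ∈ T × v ∉ R
    -- R grows by one vertex per round and ∣ R ∣ ≤ n, so the fuel k never runs out.
    grow : ∀ k R → n ≤ ∣ R ∣ + k → u ∈ R → R ⊆ T → (∀ {r} → r ∈ R → Reach G T u r) → ReachOrCut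
    grow k R fuel u∈R R⊆T reach
      with any? (λ r → any? λ w → r ∈? R ×-dec w ∈? T ×-dec ¬? (w ∈? R) ×-dec adj G r w ≟ᵇ true)
    ... | yes (r , w , r∈R , w∈T , w∉R , e) = grow′ k fuel
      where
      R′ = R ∪ ⁅ w ⁆
      ∣R∣<∣R′∣ : ∣ R ∣ < ∣ R′ ∣
      ∣R∣<∣R′∣ = p⊂q⇒∣p∣<∣q∣ (p⊆p∪q ⁅ w ⁆ , w , x∈p∪q⁺ (inj₂ (x∈⁅x⁆ w)) , w∉R)
      reach′ : ∀ {x} → x ∈ R′ → Reach G T u x
      reach′ x∈ with x∈p∪q⁻ R ⁅ w ⁆ x∈
      ... | inj₁ x∈R = reach x∈R
      ... | inj₂ x∈w = subst (Reach G T u) (sym (x∈⁅y⁆⇒x≡y w x∈w)) (Reach-snoc (reach r∈R) e w∈T)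
      grow′ : ∀ k → n ≤ ∣ R ∣ + k → ReachOrCut
      grow′ zero fuel = contradiction (∣p∣≤n R′)
        (<⇒≱ (≤-<-trans (≤-trans fuel (≤-reflexive (+-identityʳ ∣ R ∣))) ∣R∣<∣R′∣))
      grow′ (suc k) fuel = grow k R′
        (≤-trans fuel (≤-trans (≤-reflexive (+-suc ∣ R ∣ k)) (+-monoˡ-≤ k ∣R∣<∣R′∣)))
        (p⊆p∪q ⁅ w ⁆ u∈R) (p⊆r∧q⊆r⇒p∪q⊆r R⊆T (x∈p⇒⁅x⁆⊆p w∈T)) reach′
    ... | no ∄edge with ⊆-or-∃∉ T R
    ...   | inj₁ T⊆R = inj₁ λ v∈T → reach (T⊆R v∈T)
    ...   | inj₂ (v , v∈T , v∉R) = inj₂ (R , u∈R , R⊆T , closed , v , v∈T , v∉R)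
      where
      closed : Closed T R
      closed q y q∈R y∈T e = decidable-stable (y ∈? R) λ y∉R → ∄edge (q , y , q∈R , y∈T , y∉R , e)

  ∣nbhd∣<∣cnbhd∣ : u ∈ S → ∣ nbhd G S u ∣ < ∣ cnbhd G S u ∣
  ∣nbhd∣<∣cnbhd∣ {u = u} {S = S} u∈S =
    p⊂q⇒∣p∣<∣q∣ (nbhd⊆cnbhd {S = S} , u , u∈cnbhd-u u∈S , u∉nbhd-u {S = S})

  CoreStep-⊆ : CoreStep G T T′ → T′ ⊆ T
  CoreStep-⊆ (remove-vertex v _ _)       = p─q⊆p _ _
  CoreStep-⊆ (remove-pair u v _ _ _ _) x∈ = p─q⊆p _ _ (p─q⊆p _ _ x∈)

  Star-⊆ : Star (CoreStep G) T C → C ⊆ T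
  Star-⊆ ε           x∈ = x∈
  Star-⊆ (s ◅ steps) x∈ = CoreStep-⊆ s (Star-⊆ steps x∈)

  CoreStep-removed⇒degree≤3 : CoreStep G T T′ → w ∈ T → w ∉ T′ → ∣ nbhd G T w ∣ ≤ 3
  CoreStep-removed⇒degree≤3 (remove-vertex v _ deg) w∈T w∉
    rewrite x∈p∧x∉p-y⇒x≡y w∈T w∉ = ≤-trans deg (n≤1+n 2)
  CoreStep-removed⇒degree≤3 {T = T} {w = w} (remove-pair u v u∈T v∈T _ card) w∈T w∉ with w ∈? T - u
  ... | yes w∈T-u rewrite x∈p∧x∉p-y⇒x≡y w∈T-u w∉ =
    ≤-pred (<-≤-trans (<-≤-trans (∣nbhd∣<∣cnbhd∣ {S = T} v∈T)
                                 (∣q∣≤∣p∪q∣ (cnbhd G T u) (cnbhd G T v))) card)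
  ... | no w∉T-u rewrite x∈p∧x∉p-y⇒x≡y w∈T w∉T-u =
    ≤-pred (<-≤-trans (<-≤-trans (∣nbhd∣<∣cnbhd∣ {S = T} u∈T)
                                 (∣p∣≤∣p∪q∣ (cnbhd G T u) (cnbhd G T v))) card)

  removed⇒degree≤3 : Star (CoreStep G) T C → w ∈ T → w ∉ C → ∣ nbhd G C w ∣ ≤ 3
  removed⇒degree≤3 ε w∈T w∉C = contradiction w∈T w∉C
  removed⇒degree≤3 {w = w} (_◅_ {j = T′} s steps) w∈T w∉C with w ∈? T′
  ... | yes w∈T′ = removed⇒degree≤3 steps w∈T′ w∉C
  ... | no w∉T′  = ≤-trans (p⊆q⇒∣p∣≤∣q∣ (nbhd-mono (CoreStep-⊆ s ∘ Star-⊆ steps)))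
                           (CoreStep-removed⇒degree≤3 s w∈T w∉T′)

  Irreducible : Subset n → Set
  Irreducible C = ∀ C′ → ¬ CoreStep G C C′

  irreducible⇒3≤degree : Irreducible C → v ∈ C → 3 ≤ ∣ nbhd G C v ∣
  irreducible⇒3≤degree {C = C} {v = v} irr v∈C with 3 ≤? ∣ nbhd G C v ∣
  ... | yes 3≤deg = 3≤deg
  ... | no  3≰deg = contradiction (remove-vertex v v∈C (≤-pred (≰⇒> 3≰deg))) (irr _)

  irreducible⇒neighbour∉ : Irreducible C → v ∈ C → ∣ X ∣ ≤ 2 →
                           ∃ λ w → w ∈ C × adj G v w ≡ true × w ∉ X
  irreducible⇒neighbour∉ {C = C} {v = v} irr v∈C ∣X∣≤2
    with ∣q∣<∣p∣⇒∃∈p∧∉q (≤-<-trans ∣X∣≤2 (irreducible⇒3≤degree irr v∈C))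
  ... | w , w∈N , w∉X with ∈-nbhd⁻ {S = C} {u = v} w∈N
  ...   | w∈C , e = w , w∈C , e , w∉X

  irreducible⇒4<∣Z∣ : Irreducible C → u ∈ C → v ∈ C → u ≢ v →
                      cnbhd G C u ⊆ Z → cnbhd G C v ⊆ Z → 4 < ∣ Z ∣
  irreducible⇒4<∣Z∣ {u = u} {v = v} irr u∈C v∈C u≢v Nu⊆Z Nv⊆Z = ≰⇒> λ ∣Z∣≤4 →
    irr _ (remove-pair u v u∈C v∈C u≢v (≤-trans (p⊆q⇒∣p∣≤∣q∣ (p⊆r∧q⊆r⇒p∪q⊆r Nu⊆Z Nv⊆Z)) ∣Z∣≤4))

  threeConnected-closed⇒⊆∪ : ThreeConnected G S → X ⊆ S → ∣ X ∣ ≤ 2 →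
                             Closed (S ─ X) Q → u ∈ Q → u ∈ S ─ X → S ⊆ X ∪ Q
  threeConnected-closed⇒⊆∪ {X = X} (_ , conn) X⊆S ∣X∣≤2 closed u∈Q u∈S─X {s} s∈S with s ∈? X
  ... | yes s∈X = x∈p∪q⁺ (inj₁ s∈X)
  ... | no  s∉X = x∈p∪q⁺ (inj₂ (Reach-closed closed u∈Q
                    (conn X X⊆S ∣X∣≤2 _ _ u∈S─X (x∈p∧x∉q⇒x∈p─q s∈S s∉X))))

  -- In a 3-connected S, the at most two vertices of Z outside P cannot
  -- separate P from the rest of S, so P ∩ S ≠ ∅ would force S ⊆ Z.
  threeConnected⇒enclosed∉ : ThreeConnected G S → 5 ≤ ∣ S ∣ → S ⊆ T → P ⊆ T →
                             (∀ {p} → p ∈ P → cnbhd G T p ⊆ Z) → ∣ Z ∣ ≤ 4 → ∣ Z ─ P ∣ ≤ 2 →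
                             u ∈ P → u ∉ S
  threeConnected⇒enclosed∉ {S = S} {T = T} {P = P} {Z = Z} {u = u}
    S-3conn 5≤∣S∣ S⊆T P⊆T N⊆Z ∣Z∣≤4 ∣Z─P∣≤2 u∈P u∈S = <⇒≱ (s≤s ∣S∣≤4) 5≤∣S∣
    where
    R = S ∩ (Z ─ P)
    R⊆S : R ⊆ S
    R⊆S = proj₁ ∘ x∈p∩q⁻ S _
    R⊆Z─P : R ⊆ Z ─ P
    R⊆Z─P = proj₂ ∘ x∈p∩q⁻ S _
    closed : Closed (S ─ R) P
    closed p y p∈P y∈S─R e with y ∈? P
    ... | yes y∈P = y∈P
    ... | no  y∉P = contradiction (x∈p∩q⁺ (y∈S , x∈p∧x∉q⇒x∈p─q y∈Z y∉P)) (x∈p─q⇒x∉q y∈S─R)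
      where
      y∈S = p─q⊆p S R y∈S─R
      y∈Z = N⊆Z p∈P (∈-cnbhd⁺ (S⊆T y∈S) (inj₁ e))
    u∈S─R : u ∈ S ─ R
    u∈S─R = x∈p∧x∉q⇒x∈p─q u∈S λ u∈R → x∈p─q⇒x∉q (R⊆Z─P u∈R) u∈P
    S⊆R∪P : S ⊆ R ∪ P
    S⊆R∪P = threeConnected-closed⇒⊆∪ S-3conn R⊆S (≤-trans (p⊆q⇒∣p∣≤∣q∣ R⊆Z─P) ∣Z─P∣≤2) closed u∈P u∈S─R
    R∪P⊆Z : R ∪ P ⊆ Z
    R∪P⊆Z = p⊆r∧q⊆r⇒p∪q⊆r (p─q⊆p Z P ∘ R⊆Z─P) λ p∈P → N⊆Z p∈P (u∈cnbhd-u (P⊆T p∈P))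
    ∣S∣≤4 : ∣ S ∣ ≤ 4
    ∣S∣≤4 = ≤-trans (p⊆q⇒∣p∣≤∣q∣ (R∪P⊆Z ∘ S⊆R∪P)) ∣Z∣≤4

  threeConnected⇒low-degree∉ : ThreeConnected G S → 5 ≤ ∣ S ∣ → S ⊆ T → v ∈ T →
                               ∣ nbhd G T v ∣ ≤ 2 → v ∉ S
  threeConnected⇒low-degree∉ {T = T} {v = v} S-3conn 5≤∣S∣ S⊆T v∈T deg =
    threeConnected⇒enclosed∉ S-3conn 5≤∣S∣ S⊆T (x∈p⇒⁅x⁆⊆p v∈T) cnbhd⊆N ∣N∣≤4
      (≤-trans (p⊆q⇒∣p∣≤∣q∣ (p∪q─q⊆p (nbhd G T v) ⁅ v ⁆)) deg) (x∈⁅x⁆ v)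
    where
    cnbhd⊆N : ∀ {p} → p ∈ ⁅ v ⁆ → cnbhd G T p ⊆ nbhd G T v ∪ ⁅ v ⁆
    cnbhd⊆N p∈ rewrite x∈⁅y⁆⇒x≡y v p∈ = cnbhd⊆nbhd∪⁅u⁆ {S = T}
    ∣N∣≤4 : ∣ nbhd G T v ∪ ⁅ v ⁆ ∣ ≤ 4
    ∣N∣≤4 = ≤-trans (∣p∪q∣≤∣p∣+∣q∣ (nbhd G T v) ⁅ v ⁆)
                    (+-mono-≤ (≤-trans deg (n≤1+n 2)) (≤-reflexive (∣⁅x⁆∣≡1 v)))

  threeConnected⇒tight-pair∉ : ThreeConnected G S → 5 ≤ ∣ S ∣ → S ⊆ T → u ∈ T → v ∈ T → u ≢ v →
                               ∣ cnbhd G T u ∪ cnbhd G T v ∣ ≤ 4 → u ∉ S × v ∉ S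
  threeConnected⇒tight-pair∉ {S = S} {T = T} {u = u} {v = v} S-3conn 5≤∣S∣ S⊆T u∈T v∈T u≢v ∣N∣≤4 =
    enclosed∉ (x∈p∪q⁺ (inj₁ (x∈⁅x⁆ u))) , enclosed∉ (x∈p∪q⁺ (inj₂ (x∈⁅x⁆ v)))
    where
    N = cnbhd G T u ∪ cnbhd G T v
    U = ⁅ u ⁆ ∪ ⁅ v ⁆
    cnbhd⊆N : ∀ {p} → p ∈ U → cnbhd G T p ⊆ N
    cnbhd⊆N p∈ with x∈p∪q⁻ ⁅ u ⁆ ⁅ v ⁆ p∈
    ... | inj₁ p∈u rewrite x∈⁅y⁆⇒x≡y u p∈u = p⊆p∪q _
    ... | inj₂ p∈v rewrite x∈⁅y⁆⇒x≡y v p∈v = q⊆p∪q _ _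
    u∈N : u ∈ N
    u∈N = p⊆p∪q _ (u∈cnbhd-u u∈T)
    v∈N-u : v ∈ N - u
    v∈N-u = x∈p∧x≢y⇒x∈p-y (q⊆p∪q _ _ (u∈cnbhd-u v∈T)) (u≢v ∘ sym)
    ∣N─U∣≤2 : ∣ N ─ U ∣ ≤ 2
    ∣N─U∣≤2 rewrite sym (p─q─r≡p─q∪r N ⁅ u ⁆ ⁅ v ⁆) =
      ≤-pred (≤-pred (≤-trans (s≤s (x∈p⇒∣p-x∣<∣p∣ v∈N-u)) (≤-trans (x∈p⇒∣p-x∣<∣p∣ u∈N) ∣N∣≤4)))
    enclosed∉ : ∀ {w} → w ∈ U → w ∉ S
    enclosed∉ = threeConnected⇒enclosed∉ S-3conn 5≤∣S∣ S⊆T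
                  (p⊆r∧q⊆r⇒p∪q⊆r (x∈p⇒⁅x⁆⊆p u∈T) (x∈p⇒⁅x⁆⊆p v∈T)) cnbhd⊆N ∣N∣≤4 ∣N─U∣≤2

  threeConnected-survives-step : ThreeConnected G S → 5 ≤ ∣ S ∣ → S ⊆ T → CoreStep G T T′ → S ⊆ T′
  threeConnected-survives-step S-3conn 5≤∣S∣ S⊆T (remove-vertex v v∈T deg) x∈S =
    x∈p∧x≢y⇒x∈p-y (S⊆T x∈S) λ { refl → threeConnected⇒low-degree∉ S-3conn 5≤∣S∣ S⊆T v∈T deg x∈S }
  threeConnected-survives-step S-3conn 5≤∣S∣ S⊆T (remove-pair u v u∈T v∈T u≢v card) x∈S
    with threeConnected⇒tight-pair∉ S-3conn 5≤∣S∣ S⊆T u∈T v∈T u≢v card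
  ... | u∉S , v∉S = x∈p∧x≢y⇒x∈p-y (x∈p∧x≢y⇒x∈p-y (S⊆T x∈S) λ { refl → u∉S x∈S }) λ { refl → v∉S x∈S }

  threeConnected-survives : ThreeConnected G S → 5 ≤ ∣ S ∣ → Star (CoreStep G) T C → S ⊆ T → S ⊆ C
  threeConnected-survives S-3conn 5≤∣S∣ ε           S⊆T = S⊆T
  threeConnected-survives S-3conn 5≤∣S∣ (s ◅ steps) S⊆T =
    threeConnected-survives S-3conn 5≤∣S∣ steps (threeConnected-survives-step S-3conn 5≤∣S∣ S⊆T s)

  Separates : Subset n → Subset n → Subset n → Set
  Separates C X A = ∣ X ∣ ≤ 2 × A ⊆ C ─ X × Nonempty A × Nonempty (C ─ X ─ A) × Closed (C ─ X) A

  separation? : ∀ C → Dec (∃₂ (Separates C))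
  separation? C = anySubset? λ X → anySubset? λ A →
    ∣ X ∣ ≤? 2 ×-dec A ⊆? C ─ X ×-dec nonempty? A ×-dec nonempty? (C ─ X ─ A) ×-dec closed? (C ─ X) A

  no-separation⇒threeConnected : ¬ ∃₂ (Separates C) → 4 ≤ ∣ C ∣ → ThreeConnected G C
  no-separation⇒threeConnected {C = C} ∄sep 4≤∣C∣ = 4≤∣C∣ , connected
    where
    connected : ∀ X → X ⊆ C → ∣ X ∣ ≤ 2 → Connected G (C ─ X)
    connected X _ ∣X∣≤2 u v u∈ v∈ with reach-or-cut u∈
    ... | inj₁ reach = reach v∈
    ... | inj₂ (R , u∈R , R⊆ , R-closed , w , w∈ , w∉R) =
      ⊥-elim (∄sep (X , R , ∣X∣≤2 , R⊆ , (u , u∈R) , (w , x∈p∧x∉q⇒x∈p─q w∈ w∉R) , R-closed))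

  closed⇒cnbhd⊆∪ : Closed (C ─ X) P → u ∈ P → cnbhd G C u ⊆ P ∪ X
  closed⇒cnbhd⊆∪ {C = C} {X = X} {u = u} P-closed u∈P {z} z∈ with ∈-cnbhd⁻ {S = C} {u = u} z∈ | z ∈? X
  ... | _   , inj₂ refl | _       = x∈p∪q⁺ (inj₁ u∈P)
  ... | _   , inj₁ e    | yes z∈X = x∈p∪q⁺ (inj₂ z∈X)
  ... | z∈C , inj₁ e    | no  z∉X = x∈p∪q⁺ (inj₁ (P-closed u z u∈P (x∈p∧x∉q⇒x∈p─q z∈C z∉X) e))

  irreducible⇒side-neighbour : Irreducible C → ∣ X ∣ ≤ 2 → Closed (C ─ X) P → u ∈ P → u ∈ C →
                               ∃ λ w → w ∈ P × adj G u w ≡ true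
  irreducible⇒side-neighbour {u = u} irr ∣X∣≤2 P-closed u∈P u∈C with irreducible⇒neighbour∉ irr u∈C ∣X∣≤2
  ... | w , w∈C , e , w∉X = w , P-closed u w u∈P (x∈p∧x∉q⇒x∈p─q w∈C w∉X) e , e

  -- A side P with at most two vertices, together with X, would hold the closed
  -- neighbourhoods of two adjacent vertices of P.
  irreducible⇒3≤∣side∣ : Irreducible C → ∣ X ∣ ≤ 2 → P ⊆ C ─ X → Closed (C ─ X) P → Nonempty P →
                         3 ≤ ∣ P ∣
  irreducible⇒3≤∣side∣ {C = C} {X = X} {P = P} irr ∣X∣≤2 P⊆C─X P-closed (u , u∈P)
    with irreducible⇒side-neighbour irr ∣X∣≤2 P-closed u∈P (p─q⊆p C X (P⊆C─X u∈P))
  ... | w , w∈P , e =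
    +-cancelʳ-≤ 2 3 ∣ P ∣ (≤-trans 4<∣P∪X∣ (≤-trans (∣p∪q∣≤∣p∣+∣q∣ P X) (+-mono-≤ ≤-refl ∣X∣≤2)))
    where
    4<∣P∪X∣ : 4 < ∣ P ∪ X ∣
    4<∣P∪X∣ = irreducible⇒4<∣Z∣ irr (p─q⊆p C X (P⊆C─X u∈P)) (p─q⊆p C X (P⊆C─X w∈P)) (adj⇒≢ e)
                (closed⇒cnbhd⊆∪ P-closed u∈P) (closed⇒cnbhd⊆∪ P-closed w∈P)

  CompleteBetween : Subset n → Subset n → Set
  CompleteBetween A B = ∀ {a b} → a ∈ A → b ∈ B → adj G a b ≡ true

  completeBetween⇒∣A∪B∣≡∣A∣+∣B∣ : CompleteBetween A B → ∣ A ∪ B ∣ ≡ ∣ A ∣ + ∣ B ∣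
  completeBetween⇒∣A∪B∣≡∣A∣+∣B∣ {A = A} {B = B} complete =
    disjoint⇒∣p∪q∣≡∣p∣+∣q∣ A B λ x∈A x∈B → adj⇒≢ (complete x∈A x∈B) refl

  completeBetween⇒connected : CompleteBetween A B → 3 ≤ ∣ A ∣ → 3 ≤ ∣ B ∣ → ∣ Y ∣ ≤ 2 →
                              Connected G (A ∪ B ─ Y)
  completeBetween⇒connected {A = A} {B = B} {Y = Y} complete 3≤∣A∣ 3≤∣B∣ ∣Y∣≤2
    with ∣q∣<∣p∣⇒∃∈p∧∉q (≤-<-trans ∣Y∣≤2 3≤∣A∣) | ∣q∣<∣p∣⇒∃∈p∧∉q (≤-<-trans ∣Y∣≤2 3≤∣B∣)
  ... | a , a∈A , a∉Y | b , b∈B , b∉Y = λ u v u∈ v∈ → Reach-trans (to-a u∈) (Reach-sym v∈ (to-a v∈))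
    where
    a∈ : a ∈ A ∪ B ─ Y
    a∈ = x∈p∧x∉q⇒x∈p─q (x∈p∪q⁺ (inj₁ a∈A)) a∉Y
    b∈ : b ∈ A ∪ B ─ Y
    b∈ = x∈p∧x∉q⇒x∈p─q (x∈p∪q⁺ (inj₂ b∈B)) b∉Y
    to-a : ∀ {x} → x ∈ A ∪ B ─ Y → Reach G (A ∪ B ─ Y) x a
    to-a x∈ with x∈p∪q⁻ A B (p─q⊆p _ Y x∈)
    ... | inj₁ x∈A = step (complete x∈A b∈B) b∈ (step (trans (adj-sym G b a) (complete a∈A b∈B)) a∈ here)
    ... | inj₂ x∈B = step (trans (adj-sym G _ a) (complete a∈A x∈B)) a∈ here

  exit-or-cnbhd⊆ : v ∈ X → (∃ λ z → z ∈ D ─ Y × z ∉ X × adj G v z ≡ true) ⊎ cnbhd G D v ⊆ Y ∪ X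
  exit-or-cnbhd⊆ {v = v} {X = X} {D = D} {Y = Y} v∈X
    with any? (λ z → z ∈? D ─ Y ×-dec ¬? (z ∈? X) ×-dec adj G v z ≟ᵇ true)
  ... | yes exit = inj₁ exit
  ... | no ∄exit = inj₂ trapped
    where
    trapped : cnbhd G D v ⊆ Y ∪ X
    trapped {z} z∈ with ∈-cnbhd⁻ {S = D} {u = v} z∈ | z ∈? Y | z ∈? X
    ... | _         | yes z∈Y | _       = x∈p∪q⁺ (inj₁ z∈Y)
    ... | _         | no  _   | yes z∈X = x∈p∪q⁺ (inj₂ z∈X)
    ... | _ , inj₂ refl | no _ | no z∉X = contradiction v∈X z∉X
    ... | z∈D , inj₁ e  | no z∉Y | no z∉X = ⊥-elim (∄exit (z , x∈p∧x∉q⇒x∈p─q z∈D z∉Y , z∉X , e))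

  -- A walk of length at most two leaves X: otherwise two adjacent vertices of X
  -- have their closed neighbourhoods inside Y ∪ X, which has at most four vertices.
  irreducible⇒escape : Irreducible D → ∣ Y ∣ ≤ 2 → ∣ X ∣ ≤ 2 → w ∈ D ─ Y →
                       ∃ λ z → z ∈ D ─ Y × z ∉ X × Reach G (D ─ Y) w z
  irreducible⇒escape {D = D} {Y = Y} {X = X} {w = w} irr ∣Y∣≤2 ∣X∣≤2 w∈D─Y with w ∈? X
  ... | no  w∉X = w , w∈D─Y , w∉X , here
  ... | yes w∈X with exit-or-cnbhd⊆ {D = D} {Y = Y} w∈X
  ...   | inj₁ (z , z∈ , z∉X , e) = z , z∈ , z∉X , step e z∈ here
  ...   | inj₂ Nw⊆Y∪X with irreducible⇒neighbour∉ irr (p─q⊆p D Y w∈D─Y) ∣Y∣≤2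
  ...     | y , y∈D , e , y∉Y with x∈p∪q⁻ Y X (Nw⊆Y∪X (∈-cnbhd⁺ y∈D (inj₁ e)))
  ...       | inj₁ y∈Y = contradiction y∈Y y∉Y
  ...       | inj₂ y∈X with exit-or-cnbhd⊆ {D = D} {Y = Y} y∈X
  ...         | inj₁ (z , z∈ , z∉X , e′) = z , z∈ , z∉X , step e y∈D─Y (step e′ z∈ here)
    where y∈D─Y = x∈p∧x∉q⇒x∈p─q y∈D y∉Y
  ...         | inj₂ Ny⊆Y∪X = contradiction
    (irreducible⇒4<∣Z∣ irr (p─q⊆p D Y w∈D─Y) y∈D (adj⇒≢ e) Nw⊆Y∪X Ny⊆Y∪X)
    (≤⇒≯ (≤-trans (∣p∪q∣≤∣p∣+∣q∣ Y X) (+-mono-≤ ∣Y∣≤2 ∣X∣≤2)))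

  NotClique-mono : S ⊆ T → NotClique G S → NotClique G T
  NotClique-mono S⊆T (u , v , u∈S , v∈S , u≢v , nonadj) = u , v , S⊆T u∈S , S⊆T v∈S , u≢v , nonadj

module _ {n : ℕ} (G : Graph n) where

  private
    variable
      u v w : Fin n
      K T Q Y : Subset n

  complement-adj : u ≢ v → adj G u v ≡ false → adj (complement G) u v ≡ true
  complement-adj {u = u} {v = v} u≢v e rewrite e with u ≟ v
  ... | yes u≡v = contradiction u≡v u≢v
  ... | no  _   = refl

  complement-nonadj : adj G u v ≡ true → adj (complement G) u v ≡ false
  complement-nonadj e rewrite e = refl

  closed⇒complement-complete : Closed G T Q → CompleteBetween (complement G) Q (T ─ Q)
  closed⇒complement-complete {T = T} {Q = Q} Q-closed {a} {b} a∈Q b∈T─Q =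
    complement-adj (λ { refl → x∈p─q⇒x∉q b∈T─Q a∈Q })
                   (¬-not λ e → x∈p─q⇒x∉q b∈T─Q (Q-closed a b a∈Q (p─q⊆p T Q b∈T─Q) e))

  complement-neighbour : w ∉ K → ∣ Y ∣ + ∣ nbhd G K w ∣ < ∣ K ∣ →
                         ∃ λ k → k ∈ K ─ Y × adj (complement G) w k ≡ true
  complement-neighbour {w = w} {K = K} {Y = Y} w∉K bound
    with ∣q∣<∣p∣⇒∃∈p∧∉q (≤-<-trans (∣p∪q∣≤∣p∣+∣q∣ Y (nbhd G K w)) bound)
  ... | k , k∈K , k∉ =
    k , x∈p∧x∉q⇒x∈p─q k∈K (k∉ ∘ x∈p∪q⁺ ∘ inj₁) ,
    complement-adj (λ { refl → w∉K k∈K }) (¬-not λ e → k∉ (x∈p∪q⁺ (inj₂ (∈-nbhd⁺ G k∈K e))))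

module SeparatedCore {n : ℕ} (H : Graph n) {C D X A : Subset n}
  (C-reduction : Star (CoreStep H) ⊤ C) (C-irr : Irreducible H C)
  (D-reduction : Star (CoreStep (complement H)) ⊤ D) (D-irr : Irreducible (complement H) D)
  (∣X∣≤2 : ∣ X ∣ ≤ 2) (A⊆C─X : A ⊆ C ─ X) (A≢∅ : Nonempty A) (B≢∅ : Nonempty (C ─ X ─ A))
  (A-closed : Closed H (C ─ X) A) where

  private
    H̄ = complement H
    B = C ─ X ─ A
    K = A ∪ B

    3≤∣A∣ : 3 ≤ ∣ A ∣
    3≤∣A∣ = irreducible⇒3≤∣side∣ H C-irr ∣X∣≤2 A⊆C─X A-closed A≢∅

    3≤∣B∣ : 3 ≤ ∣ B ∣
    3≤∣B∣ = irreducible⇒3≤∣side∣ H C-irr ∣X∣≤2 (p─q⊆p _ A) (closed-complement H A-closed) B≢∅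

    A-B-complete : CompleteBetween H̄ A B
    A-B-complete = closed⇒complement-complete H A-closed

    6≤∣K∣ : 6 ≤ ∣ K ∣
    6≤∣K∣ = subst (6 ≤_) (sym (completeBetween⇒∣A∪B∣≡∣A∣+∣B∣ H̄ A-B-complete)) (+-mono-≤ 3≤∣A∣ 3≤∣B∣)

    5≤∣K∣ : 5 ≤ ∣ K ∣
    5≤∣K∣ = ≤-trans (n≤1+n 5) 6≤∣K∣

    K-connected : ∀ {Y} → ∣ Y ∣ ≤ 2 → Connected H̄ (K ─ Y)
    K-connected = completeBetween⇒connected H̄ A-B-complete 3≤∣A∣ 3≤∣B∣

    K-threeConnected : ThreeConnected H̄ K
    K-threeConnected = ≤-trans (n≤1+n 4) 5≤∣K∣ , λ Y _ → K-connected

    K⊆D : K ⊆ D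
    K⊆D = threeConnected-survives H̄ K-threeConnected 5≤∣K∣ D-reduction ⊆⊤

    K─Y⊆D─Y : ∀ {Y} → K ─ Y ⊆ D ─ Y
    K─Y⊆D─Y {Y} x∈ = x∈p∧x∉q⇒x∈p─q (K⊆D (p─q⊆p K Y x∈)) (x∈p─q⇒x∉q x∈)

    K⊆C : K ⊆ C
    K⊆C = p─q⊆p C X ∘ p⊆r∧q⊆r⇒p∪q⊆r A⊆C─X (p─q⊆p _ A)

    C─X⊆K : C ─ X ⊆ K
    C─X⊆K {y} y∈ with y ∈? A
    ... | yes y∈A = x∈p∪q⁺ (inj₁ y∈A)
    ... | no  y∉A = x∈p∪q⁺ (inj₂ (x∈p∧x∉q⇒x∈p─q y∈ y∉A))

    removed⇒complement-neighbour : ∀ {Y z} → ∣ Y ∣ ≤ 2 → z ∉ C → ∃ λ k → k ∈ K ─ Y × adj H̄ z k ≡ true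
    removed⇒complement-neighbour {Y} {z} ∣Y∣≤2 z∉C = complement-neighbour H (z∉C ∘ K⊆C) bound
      where
      ∣N∣≤3 : ∣ nbhd H K z ∣ ≤ 3
      ∣N∣≤3 = ≤-trans (p⊆q⇒∣p∣≤∣q∣ (nbhd-mono H K⊆C)) (removed⇒degree≤3 H C-reduction ∈⊤ z∉C)
      bound : ∣ Y ∣ + ∣ nbhd H K z ∣ < ∣ K ∣
      bound = <-≤-trans (s≤s (+-mono-≤ ∣Y∣≤2 ∣N∣≤3)) 6≤∣K∣

    reaches-K : ∀ {Y w} → ∣ Y ∣ ≤ 2 → w ∈ D ─ Y → ∃ λ k → k ∈ K ─ Y × Reach H̄ (D ─ Y) w k
    reaches-K ∣Y∣≤2 w∈ with irreducible⇒escape H̄ D-irr ∣Y∣≤2 ∣X∣≤2 w∈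
    ... | z , z∈D─Y , z∉X , w→z with z ∈? C
    ...   | yes z∈C = z , x∈p∧x∉q⇒x∈p─q (C─X⊆K (x∈p∧x∉q⇒x∈p─q z∈C z∉X)) (x∈p─q⇒x∉q z∈D─Y) , w→z
    ...   | no  z∉C with removed⇒complement-neighbour ∣Y∣≤2 z∉C
    ...     | k , k∈K─Y , e = k , k∈K─Y , Reach-snoc H̄ w→z e (K─Y⊆D─Y k∈K─Y)

  complement-core-threeConnected : ThreeConnected H̄ D
  complement-core-threeConnected = ≤-trans (proj₁ K-threeConnected) (p⊆q⇒∣p∣≤∣q∣ K⊆D) , connected
    where
    connected : ∀ Y → Y ⊆ D → ∣ Y ∣ ≤ 2 → Connected H̄ (D ─ Y)
    connected Y _ ∣Y∣≤2 u v u∈ v∈ with reaches-K ∣Y∣≤2 u∈ | reaches-K ∣Y∣≤2 v∈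
    ... | k₁ , k₁∈ , u→k₁ | k₂ , k₂∈ , v→k₂ =
      Reach-trans H̄ u→k₁ (Reach-trans H̄ (Reach-mono H̄ K─Y⊆D─Y (K-connected ∣Y∣≤2 k₁ k₂ k₁∈ k₂∈))
                                          (Reach-sym H̄ v∈ v→k₂))

  complement-core-notClique : NotClique H̄ D
  complement-core-notClique = notClique A≢∅
    where
    notClique : Nonempty A → NotClique H̄ D
    notClique (u , u∈A)
      with irreducible⇒side-neighbour H C-irr ∣X∣≤2 A-closed u∈A (p─q⊆p C X (A⊆C─X u∈A))
    ... | w , w∈A , e =
      u , w , K⊆D (x∈p∪q⁺ (inj₁ u∈A)) , K⊆D (x∈p∪q⁺ (inj₁ w∈A)) , adj⇒≢ H e , complement-nonadj H e

lemma5p4 : ∀ {n} (H : Graph n) →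
    (∃[ S ] (5 ≤ ∣ S ∣ × ThreeConnected H S × NotClique H S)) →
    ∀ (C : Subset n) (D : Subset n) →
    Is3StarCore H C → Is3StarCore (complement H) D →
    (ThreeConnected H C × NotClique H C) ⊎
    (ThreeConnected (complement H) D × NotClique (complement H) D)
lemma5p4 H (S , 5≤∣S∣ , S-3conn , S-notClique) C D (C-reduction , C-irr) (D-reduction , D-irr)
  with separation? H C
... | yes (X , A , ∣X∣≤2 , A⊆C─X , A≢∅ , B≢∅ , A-closed) =
  inj₂ (complement-core-threeConnected , complement-core-notClique)
  where
  open SeparatedCore H C-reduction C-irr D-reduction D-irr ∣X∣≤2 A⊆C─X A≢∅ B≢∅ A-closed
... | no ∄sep = inj₁ (no-separation⇒threeConnected H ∄sep 4≤∣C∣ , NotClique-mono H S⊆C S-notClique)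
  where
  S⊆C : S ⊆ C
  S⊆C = threeConnected-survives H S-3conn 5≤∣S∣ C-reduction ⊆⊤
  4≤∣C∣ : 4 ≤ ∣ C ∣
  4≤∣C∣ = ≤-trans (n≤1+n 4) (≤-trans 5≤∣S∣ (p⊆q⇒∣p∣≤∣q∣ S⊆C))
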